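{- Let $G$ be a multigraph whose underlying simple graph is $K_4-e$ (the complete graph on four vertices with one edge removed). Write $V(G)=\{u,v,v_1,v_2\}$, where $u$ and $v$ correspond to the two vertices of degree three in $K_4-e$ (so $v_1$ and $v_2$ are non-adjacent). The following are equivalent: (1) $G$ is rationally $K_3$-decomposable; (2) $G$ is $K_3$-decomposable; (3) $\mu(u,v)=\mu(v,v_1)+\mu(v,v_2)$, $\mu(u,v_1)=\mu(v,v_1)$ and $\mu(u,v_2)=\mu(v,v_2)$.
   Context: A multigraph may have multiple edges but no loops; $\mu(x,y)$ denotes the number of edges joining $x$ and $y$. A triangle of a multigraph is a set of three edges joining three vertices pairwise. $G$ is $K_3$-decomposable if its edge set can be partitioned into triangles. A rational $K_3$-decomposition is an assignment of nonnegative rational weights to the triangles of $G$ such that for every edge $e$, the sum of the weights of the triangles containing $e$ equals $1$; $G$ is rationally $K_3$-decomposable if such an assignment exists. -}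

module Defs where

open import Data.Nat using (ℕ; _≥_)
open import Data.Fin using (Fin; zero; suc; _<_; _≟_)
open import Data.Fin.Properties using (any?; _<?_)
open import Data.List using (List; []; _∷_; length; filter; map; foldr; allFin; concatMap)
open import Data.List.Relation.Unary.All using (All)
open import Data.Product using (Σ; ∃; _×_; _,_)
open import Data.Sum using (_⊎_)
open import Data.Rational using (ℚ; 0ℚ; 1ℚ; _+_; _≤_)
open import Relation.Nullary using (¬_; Dec; does)
open import Relation.Nullary.Decidable using (_×-dec_; _⊎-dec_; ¬?)
open import Relation.Binary.PropositionalEquality using (_≡_; _≢_)
open import Data.Bool using (if_then_else_)

V : Set
V = Fin 4

u v v₁ v₂ : V
u  = zero
v  = suc zero
v₁ = suc (suc zero)
v₂ = suc (suc (suc zero))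

record Multigraph : Set where
  field
    m     : ℕ
    end₁  : Fin m → V
    end₂  : Fin m → V
    loopless : ∀ e → end₁ e ≢ end₂ e
open Multigraph public

Edge : Multigraph → Set
Edge G = Fin (m G)

Joins : (G : Multigraph) → Edge G → V → V → Set
Joins G e x y = (end₁ G e ≡ x × end₂ G e ≡ y) ⊎ (end₁ G e ≡ y × end₂ G e ≡ x)

joins? : (G : Multigraph) (e : Edge G) (x y : V) → Dec (Joins G e x y)
joins? G e x y = ((end₁ G e ≟ x) ×-dec (end₂ G e ≟ y)) ⊎-dec ((end₁ G e ≟ y) ×-dec (end₂ G e ≟ x))

count : ∀ {n} {P : Fin n → Set} → (∀ i → Dec (P i)) → ℕ
count {n} P? = length (filter P? (allFin n))

μ : (G : Multigraph) → V → V → ℕ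
μ G x y = count (λ e → joins? G e x y)

IsTriangle : (G : Multigraph) → Edge G → Edge G → Edge G → Set
IsTriangle G a b c =
  Σ V λ x → Σ V λ y → Σ V λ z →
    (x ≢ y) × (y ≢ z) × (x ≢ z) × Joins G a x y × Joins G b y z × Joins G c x z

isTriangle? : (G : Multigraph) (a b c : Edge G) → Dec (IsTriangle G a b c)
isTriangle? G a b c = any? λ x → any? λ y → any? λ z →
  ¬? (x ≟ y) ×-dec ¬? (y ≟ z) ×-dec ¬? (x ≟ z) ×-dec
  joins? G a x y ×-dec joins? G b y z ×-dec joins? G c x z

_∈₃_ : ∀ {n} → Fin n → Fin n × Fin n × Fin n → Set
e ∈₃ (a , b , c) = e ≡ a ⊎ e ≡ b ⊎ e ≡ c

∈₃? : ∀ {n} (e : Fin n) (t : Fin n × Fin n × Fin n) → Dec (e ∈₃ t)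
∈₃? e (a , b , c) = (e ≟ a) ⊎-dec (e ≟ b) ⊎-dec (e ≟ c)

K3Decomposable : Multigraph → Set
K3Decomposable G =
  Σ (List (Edge G × Edge G × Edge G)) λ T →
    All (λ { (a , b , c) → IsTriangle G a b c }) T ×
    (∀ e → length (filter (∈₃? e) T) ≡ 1)

-- Each triangle (a set of three edges) is represented once, as a triple a < b < c.
CanonTriangle : (G : Multigraph) → Edge G → Edge G → Edge G → Set
CanonTriangle G a b c = (a < b) × (b < c) × IsTriangle G a b c

canonTriangle? : (G : Multigraph) (a b c : Edge G) → Dec (CanonTriangle G a b c)
canonTriangle? G a b c = (a <? b) ×-dec (b <? c) ×-dec isTriangle? G a b c

sumℚ : List ℚ → ℚ
sumℚ = foldr _+_ 0ℚ

weightAt : (G : Multigraph) → (Edge G → Edge G → Edge G → ℚ) → Edge G → ℚ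
weightAt G w e =
  sumℚ (concatMap (λ a → concatMap (λ b → map (λ c →
     if does (canonTriangle? G a b c ×-dec ∈₃? e (a , b , c)) then w a b c else 0ℚ)
     (allFin (m G))) (allFin (m G))) (allFin (m G)))

-- Rational K₃-decomposition: nonnegative rational weights on the triangles,
-- summing to 1 at every edge.  (Values of w on non-triangles are irrelevant.)
RationallyK3Decomposable : Multigraph → Set
RationallyK3Decomposable G =
  Σ (Edge G → Edge G → Edge G → ℚ) λ w →
    (∀ a b c → CanonTriangle G a b c → 0ℚ ≤ w a b c) ×
    (∀ e → weightAt G w e ≡ 1ℚ)

-- The underlying simple graph of G is K₄ − e, with v₁ v₂ the missing edge
-- (so u, v are the two vertices of degree three).
UnderlyingK4-e : Multigraph → Set
UnderlyingK4-e G =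
  μ G u v ≥ 1 × μ G u v₁ ≥ 1 × μ G u v₂ ≥ 1 ×
  μ G v v₁ ≥ 1 × μ G v v₂ ≥ 1 × μ G v₁ v₂ ≡ 0

module Submission where

open import Defs
open import Data.Nat as ℕ using (ℕ; zero; suc)
import Data.Nat.Properties as ℕP
open import Data.Fin using (Fin; zero; suc; _≟_; _<?_) renaming (_<_ to _<ᶠ_)
import Data.Fin.Properties as FinP
open import Data.Bool using (Bool; true; false; _∧_; _∨_; if_then_else_)
import Data.Bool.Properties as BoolP
open import Data.List using (List; []; _∷_; _++_; length; filter; map; concatMap; allFin; tabulate; lookup; take; drop; zip)
import Data.List.Properties as ListP
open import Data.List.Membership.Propositional.Properties using (∈-lookup)
open import Data.List.Relation.Unary.All as All using (All; []; _∷_)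
import Data.List.Relation.Unary.All.Properties as AllP
open import Data.Product using (_×_; _,_; proj₁; proj₂)
open import Data.Sum using (_⊎_; inj₁; inj₂)
open import Data.Unit using (tt)
open import Data.Empty using (⊥-elim)
open import Data.Rational using (ℚ; 0ℚ; 1ℚ; _+_; _*_; _≤_; _<_)
import Data.Rational.Properties as ℚP
open import Data.Rational.Solver using (module +-*-Solver)
open import Algebra.Bundles using (Ring)
open import Algebra.Properties.Semiring.Sum (Ring.semiring ℚP.+-*-ring)
  using (sum; sum-cong-≗; sum-replicate-zero; ∑-distrib-+; ∑-comm; *-distribˡ-sum)
open import Algebra.Properties.Monoid.Mult ℚP.+-0-monoid using (×-homo-+) renaming (_×_ to _·_)
open import Function using (_∘_; id)
open import Function.Bundles using (_⇔_; mk⇔)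
open import Relation.Nullary using (Dec; yes; no; does; ¬_)
open import Relation.Nullary.Decidable using (_×-dec_; _⊎-dec_; _→-dec_; ¬?; dec-true; toWitness)
open import Relation.Binary.Definitions using (tri<; tri≈; tri>)
open import Relation.Binary.PropositionalEquality
open +-*-Solver using (solve; _:+_; _:*_; _:=_)

-- Double counting: if the weights w sum to 1 at every edge, then for
-- every function φ on edges, Σₑ φ(e) = Σₜ w(t)·(φ summed over the edges of t).
-- Hence a linear relation between the edge indicators 𝟙_pq that holds on every
-- triangle holds for their totals μ(p,q).  Since v₁v₂ is not an edge, every
-- triangle of G lies over uvv₁ or uvv₂, so it satisfies the balance relations
-- (a finite check on the vertex set).
-- (3) ⇒ (2).  An explicit decomposition: the first μ(v,v₁) uv-edges are zipped
-- with the uv₁- and vv₁-edges, the remaining μ(v,v₂) with the uv₂- and vv₂-edges.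
-- (2) ⇒ (1), for any multigraph.  Weight each canonical (sorted) triangle by the
-- number of triangles of the decomposition with the same three edges.

ι : Bool → ℚ
ι true  = 1ℚ
ι false = 0ℚ

ι-nonneg : ∀ b → 0ℚ ≤ ι b
ι-nonneg true  = ℚP.<⇒≤ (ℚP.positive⁻¹ 1ℚ)
ι-nonneg false = ℚP.≤-refl

ι-∧ : ∀ p q → ι (p ∧ q) ≡ ι p * ι q
ι-∧ true  q = sym (ℚP.*-identityˡ (ι q))
ι-∧ false q = sym (ℚP.*-zeroˡ (ι q))

if-as-ι : ∀ b x → (if b then x else 0ℚ) ≡ ι b * x
if-as-ι true  x = sym (ℚP.*-identityˡ x)
if-as-ι false x = sym (ℚP.*-zeroˡ x)

-- The embedding ℕ → ℚ, n ↦ n·1; it is additive (library) and injective, so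
-- identities between edge counts may be proved in ℚ and transported back.
⟦_⟧ : ℕ → ℚ
⟦ n ⟧ = n · 1ℚ

⟦⟧-<-suc : ∀ n → ⟦ n ⟧ < ⟦ suc n ⟧
⟦⟧-<-suc n = subst (_< ⟦ suc n ⟧) (ℚP.+-identityˡ ⟦ n ⟧) (ℚP.+-monoˡ-< ⟦ n ⟧ (ℚP.positive⁻¹ 1ℚ))

⟦⟧-mono-< : ∀ {m n} → m ℕ.< n → ⟦ m ⟧ < ⟦ n ⟧
⟦⟧-mono-< {m} {suc n} m<1+n with ℕP.m<1+n⇒m<n∨m≡n m<1+n
... | inj₁ m<n  = ℚP.<-trans (⟦⟧-mono-< m<n) (⟦⟧-<-suc n)
... | inj₂ refl = ⟦⟧-<-suc n

⟦⟧-injective : ∀ {m n} → ⟦ m ⟧ ≡ ⟦ n ⟧ → m ≡ n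
⟦⟧-injective {m} {n} eq with ℕP.<-cmp m n
... | tri< m<n _ _ = ⊥-elim (ℚP.<⇒≢ (⟦⟧-mono-< m<n) eq)
... | tri≈ _ m≡n _ = m≡n
... | tri> _ _ n<m = ⊥-elim (ℚP.<⇒≢ (⟦⟧-mono-< n<m) (sym eq))

+-regroup₃ : ∀ a₁ b₁ c₁ a₂ b₂ c₂ → (a₁ + b₁ + c₁) + (a₂ + b₂ + c₂) ≡ (a₁ + a₂) + (b₁ + b₂) + (c₁ + c₂)
+-regroup₃ = solve 6 (λ a₁ b₁ c₁ a₂ b₂ c₂ →
  (a₁ :+ b₁ :+ c₁) :+ (a₂ :+ b₂ :+ c₂) := (a₁ :+ a₂) :+ (b₁ :+ b₂) :+ (c₁ :+ c₂)) refl

sum-zero : ∀ {n} (f : Fin n → ℚ) → (∀ i → f i ≡ 0ℚ) → sum f ≡ 0ℚ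
sum-zero {n} f f≡0 = trans (sum-cong-≗ f≡0) (sum-replicate-zero n)

sum-nonneg : ∀ {n} (f : Fin n → ℚ) → (∀ i → 0ℚ ≤ f i) → 0ℚ ≤ sum f
sum-nonneg {zero}  f f≥0 = ℚP.≤-refl
sum-nonneg {suc n} f f≥0 = ℚP.+-mono-≤ (f≥0 zero) (sum-nonneg (f ∘ suc) (f≥0 ∘ suc))

δ : ∀ {n} → Fin n → Fin n → ℚ
δ a e = ι (does (e ≟ a))

sum-δ : ∀ {n} (a : Fin n) (f : Fin n → ℚ) → sum (λ e → f e * δ a e) ≡ f a
sum-δ {suc n} zero f = begin
    f zero * 1ℚ + sum (λ e → f (suc e) * 0ℚ)
  ≡⟨ cong₂ _+_ (ℚP.*-identityʳ (f zero)) (sum-zero _ (ℚP.*-zeroʳ ∘ f ∘ suc)) ⟩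
    f zero + 0ℚ
  ≡⟨ ℚP.+-identityʳ (f zero) ⟩
    f zero ∎
  where open ≡-Reasoning
sum-δ {suc n} (suc a) f =
  trans (cong₂ _+_ (ℚP.*-zeroʳ (f zero)) (sum-δ a (f ∘ suc))) (ℚP.+-identityˡ (f (suc a)))

∈₃-as-ι : ∀ {n} {a b c : Fin n} → a ≢ b → b ≢ c → a ≢ c → ∀ e →
  ι (does (∈₃? e (a , b , c))) ≡ δ a e + δ b e + δ c e
∈₃-as-ι {a = a} {b} {c} a≢b b≢c a≢c e with e ≟ a | e ≟ b | e ≟ c
... | yes e≡a | yes e≡b | _       = ⊥-elim (a≢b (trans (sym e≡a) e≡b))
... | yes e≡a | no _    | yes e≡c = ⊥-elim (a≢c (trans (sym e≡a) e≡c))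
... | no _    | yes e≡b | yes e≡c = ⊥-elim (b≢c (trans (sym e≡b) e≡c))
... | yes _   | no _    | no _    = refl
... | no _    | yes _   | no _    = refl
... | no _    | no _    | yes _   = refl
... | no _    | no _    | no _    = refl

sum-δ₃ : ∀ {n} {a b c : Fin n} → a ≢ b → b ≢ c → a ≢ c → (f : Fin n → ℚ) →
  sum (λ e → f e * ι (does (∈₃? e (a , b , c)))) ≡ f a + f b + f c
sum-δ₃ {n} {a} {b} {c} a≢b b≢c a≢c f = begin
    sum (λ e → f e * ι (does (∈₃? e (a , b , c))))
  ≡⟨ sum-cong-≗ (λ e → trans (cong (f e *_) (∈₃-as-ι a≢b b≢c a≢c e)) (distrib (f e) _ _ _)) ⟩
    sum (λ e → f e * δ a e + f e * δ b e + f e * δ c e)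
  ≡⟨ ∑-distrib-+ (λ e → f e * δ a e + f e * δ b e) (λ e → f e * δ c e) ⟩
    sum (λ e → f e * δ a e + f e * δ b e) + sum (λ e → f e * δ c e)
  ≡⟨ cong (_+ sum (λ e → f e * δ c e)) (∑-distrib-+ (λ e → f e * δ a e) (λ e → f e * δ b e)) ⟩
    sum (λ e → f e * δ a e) + sum (λ e → f e * δ b e) + sum (λ e → f e * δ c e)
  ≡⟨ cong₂ _+_ (cong₂ _+_ (sum-δ a f) (sum-δ b f)) (sum-δ c f) ⟩
    f a + f b + f c ∎
  where
  open ≡-Reasoning
  distrib : ∀ x p q r → x * (p + q + r) ≡ x * p + x * q + x * r
  distrib = solve 4 (λ x p q r → x :* (p :+ q :+ r) := x :* p :+ x :* q :+ x :* r) refl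

Triple : ℕ → Set
Triple n = Fin n × Fin n × Fin n

sum³ : ∀ {n} → (Fin n → Fin n → Fin n → ℚ) → ℚ
sum³ f = sum λ a → sum λ b → sum λ c → f a b c

sum³-cong : ∀ {n} {f g : Fin n → Fin n → Fin n → ℚ} → (∀ a b c → f a b c ≡ g a b c) → sum³ f ≡ sum³ g
sum³-cong f≡g = sum-cong-≗ λ a → sum-cong-≗ λ b → sum-cong-≗ λ c → f≡g a b c

*-distribˡ-sum³ : ∀ {n} x (f : Fin n → Fin n → Fin n → ℚ) → x * sum³ f ≡ sum³ (λ a b c → x * f a b c)
*-distribˡ-sum³ x f =
  trans (*-distribˡ-sum x (λ a → sum λ b → sum λ c → f a b c)) (sum-cong-≗ λ a →
  trans (*-distribˡ-sum x (λ b → sum λ c → f a b c)) (sum-cong-≗ λ b →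
  *-distribˡ-sum x (λ c → f a b c)))

sum-sum³-comm : ∀ {k n} (f : Fin k → Fin n → Fin n → Fin n → ℚ) →
  sum (λ i → sum³ (f i)) ≡ sum³ (λ a b c → sum (λ i → f i a b c))
sum-sum³-comm f =
  trans (∑-comm (λ i a → sum λ b → sum λ c → f i a b c)) (sum-cong-≗ λ a →
  trans (∑-comm (λ i b → sum λ c → f i a b c)) (sum-cong-≗ λ b →
  ∑-comm (λ i c → f i a b c)))

δ₃ : ∀ {n} → Triple n → Fin n → Fin n → Fin n → ℚ
δ₃ (s₁ , s₂ , s₃) a b c = ι (does (a ≟ s₁) ∧ does (b ≟ s₂) ∧ does (c ≟ s₃))

δ₃-nonneg : ∀ {n} (s : Triple n) a b c → 0ℚ ≤ δ₃ s a b c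
δ₃-nonneg (s₁ , s₂ , s₃) a b c = ι-nonneg (does (a ≟ s₁) ∧ does (b ≟ s₂) ∧ does (c ≟ s₃))

sum³-δ : ∀ {n} (g : Fin n → Fin n → Fin n → ℚ) (s : Triple n) →
  sum³ (λ a b c → g a b c * δ₃ s a b c) ≡ g (proj₁ s) (proj₁ (proj₂ s)) (proj₂ (proj₂ s))
sum³-δ g (s₁ , s₂ , s₃) = begin
    sum³ (λ a b c → g a b c * δ₃ (s₁ , s₂ , s₃) a b c)
  ≡⟨ sum³-cong split ⟩
    (sum λ a → sum λ b → sum λ c → (g a b c * δ s₁ a) * δ s₂ b * δ s₃ c)
  ≡⟨ (sum-cong-≗ λ a → sum-cong-≗ λ b → sum-δ s₃ (λ c → (g a b c * δ s₁ a) * δ s₂ b)) ⟩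
    (sum λ a → sum λ b → (g a b s₃ * δ s₁ a) * δ s₂ b)
  ≡⟨ (sum-cong-≗ λ a → sum-δ s₂ (λ b → g a b s₃ * δ s₁ a)) ⟩
    (sum λ a → g a s₂ s₃ * δ s₁ a)
  ≡⟨ sum-δ s₁ (λ a → g a s₂ s₃) ⟩
    g s₁ s₂ s₃ ∎
  where
  open ≡-Reasoning
  reassoc : ∀ x p q r → x * (p * (q * r)) ≡ x * p * q * r
  reassoc = solve 4 (λ x p q r → x :* (p :* (q :* r)) := x :* p :* q :* r) refl
  split : ∀ a b c → g a b c * δ₃ (s₁ , s₂ , s₃) a b c ≡ (g a b c * δ s₁ a) * δ s₂ b * δ s₃ c
  split a b c = begin
      g a b c * ι (does (a ≟ s₁) ∧ does (b ≟ s₂) ∧ does (c ≟ s₃))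
    ≡⟨ cong (g a b c *_) (trans (ι-∧ (does (a ≟ s₁)) _) (cong (δ s₁ a *_) (ι-∧ (does (b ≟ s₂)) _))) ⟩
      g a b c * (δ s₁ a * (δ s₂ b * δ s₃ c))
    ≡⟨ reassoc (g a b c) _ _ _ ⟩
      g a b c * δ s₁ a * δ s₂ b * δ s₃ c ∎

sumℚ-++ : ∀ xs ys → sumℚ (xs ++ ys) ≡ sumℚ xs + sumℚ ys
sumℚ-++ []       ys = sym (ℚP.+-identityˡ (sumℚ ys))
sumℚ-++ (x ∷ xs) ys = trans (cong (x +_) (sumℚ-++ xs ys)) (sym (ℚP.+-assoc x (sumℚ xs) (sumℚ ys)))

sumℚ-concatMap : ∀ {A : Set} (f : A → List ℚ) xs → sumℚ (concatMap f xs) ≡ sumℚ (map (sumℚ ∘ f) xs)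
sumℚ-concatMap f []       = refl
sumℚ-concatMap f (x ∷ xs) = trans (sumℚ-++ (f x) (concatMap f xs)) (cong (sumℚ (f x) +_) (sumℚ-concatMap f xs))

sumℚ-tabulate : ∀ {A : Set} {n} (f : A → ℚ) (g : Fin n → A) → sumℚ (map f (tabulate g)) ≡ sum (f ∘ g)
sumℚ-tabulate {n = zero}  f g = refl
sumℚ-tabulate {n = suc n} f g = cong (f (g zero) +_) (sumℚ-tabulate f (g ∘ suc))

sumℚ-allFin : ∀ {n} (f : Fin n → ℚ) → sumℚ (map f (allFin n)) ≡ sum f
sumℚ-allFin f = sumℚ-tabulate f id

sumℚ-lookup : ∀ {A : Set} (f : A → ℚ) xs → sumℚ (map f xs) ≡ sum (f ∘ lookup xs)
sumℚ-lookup f []       = refl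
sumℚ-lookup f (x ∷ xs) = cong (f x +_) (sumℚ-lookup f xs)

count-as-sumℚ : ∀ {A : Set} {P : A → Set} (P? : ∀ x → Dec (P x)) xs →
  ⟦ length (filter P? xs) ⟧ ≡ sumℚ (map (ι ∘ does ∘ P?) xs)
count-as-sumℚ P? []       = refl
count-as-sumℚ P? (x ∷ xs) with does (P? x)
... | true  = cong (1ℚ +_) (count-as-sumℚ P? xs)
... | false = trans (count-as-sumℚ P? xs) (sym (ℚP.+-identityˡ _))

sumℚ-filter : ∀ {A : Set} {P : A → Set} (P? : ∀ x → Dec (P x)) (f : A → ℚ) xs →
  sumℚ (map f (filter P? xs)) ≡ sumℚ (map (λ x → ι (does (P? x)) * f x) xs)
sumℚ-filter P? f []       = refl
sumℚ-filter P? f (x ∷ xs) with does (P? x)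
... | true  = cong₂ _+_ (sym (ℚP.*-identityˡ (f x))) (sumℚ-filter P? f xs)
... | false = trans (sumℚ-filter P? f xs)
                    (sym (trans (cong (_+ _) (ℚP.*-zeroˡ (f x))) (ℚP.+-identityˡ _)))

samePair : ∀ {n} → Fin n → Fin n → Fin n → Fin n → Bool
samePair x y p q = does (((x ≟ p) ×-dec (y ≟ q)) ⊎-dec ((x ≟ q) ×-dec (y ≟ p)))

samePair-sym : ∀ {n} (x y p q : Fin n) → samePair y x p q ≡ samePair x y p q
samePair-sym x y p q = swap (does (x ≟ p)) (does (y ≟ q)) (does (x ≟ q)) (does (y ≟ p))
  where
  swap : ∀ xp yq xq yp → (yp ∧ xq) ∨ (yq ∧ xp) ≡ (xp ∧ yq) ∨ (xq ∧ yp)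
  swap xp yq xq yp rewrite BoolP.∧-comm yp xq | BoolP.∧-comm yq xp = BoolP.∨-comm (xq ∧ yp) (xp ∧ yq)

𝟙 : (G : Multigraph) → V → V → Edge G → ℚ
𝟙 G p q e = ι (does (joins? G e p q))

Joins-sym : ∀ G e {x y} → Joins G e x y → Joins G e y x
Joins-sym G e (inj₁ ends) = inj₂ ends
Joins-sym G e (inj₂ ends) = inj₁ ends

joins-samePair : ∀ G e {x y} → Joins G e x y → ∀ p q → does (joins? G e p q) ≡ samePair x y p q
joins-samePair G e (inj₁ (refl , refl)) p q = refl
joins-samePair G e (inj₂ (refl , refl)) p q = samePair-sym (end₂ G e) (end₁ G e) p q

same-ends : ∀ G e {x y x′ y′} → Joins G e x y → Joins G e x′ y′ → (x ≡ x′ × y ≡ y′) ⊎ (x ≡ y′ × y ≡ x′)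
same-ends G e (inj₁ (refl , refl)) (inj₁ (refl , refl)) = inj₁ (refl , refl)
same-ends G e (inj₁ (refl , refl)) (inj₂ (refl , refl)) = inj₂ (refl , refl)
same-ends G e (inj₂ (refl , refl)) (inj₁ (refl , refl)) = inj₂ (refl , refl)
same-ends G e (inj₂ (refl , refl)) (inj₂ (refl , refl)) = inj₁ (refl , refl)

-- The three edges of a triangle are distinct, since they join different pairs.
triangle-edges-distinct : ∀ G {a b c} → IsTriangle G a b c → a ≢ b × b ≢ c × a ≢ c
triangle-edges-distinct G {a} {b} {c} (x , y , z , x≢y , y≢z , x≢z , ja , jb , jc) = a≢b , b≢c , a≢c
  where
  a≢b : a ≢ b
  a≢b refl with same-ends G a ja jb
  ... | inj₁ (x≡y , _) = x≢y x≡y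
  ... | inj₂ (x≡z , _) = x≢z x≡z
  b≢c : b ≢ c
  b≢c refl with same-ends G b jb jc
  ... | inj₁ (y≡x , _) = x≢y (sym y≡x)
  ... | inj₂ (y≡z , _) = y≢z y≡z
  a≢c : a ≢ c
  a≢c refl with same-ends G a ja jc
  ... | inj₁ (_ , y≡z) = y≢z y≡z
  ... | inj₂ (x≡z , _) = x≢z x≡z

sides : V → V → V → V → V → ℚ
sides p q x y z = ι (samePair x y p q) + ι (samePair y z p q) + ι (samePair x z p q)

hits : (G : Multigraph) → V → V → Edge G → Edge G → Edge G → ℚ
hits G p q a b c = 𝟙 G p q a + 𝟙 G p q b + 𝟙 G p q c

hits-sides : ∀ G {a b c x y z} → Joins G a x y → Joins G b y z → Joins G c x z →
  ∀ p q → hits G p q a b c ≡ sides p q x y z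
hits-sides G {a} {b} {c} ja jb jc p q =
  cong₂ _+_ (cong₂ _+_ (cong ι (joins-samePair G a ja p q)) (cong ι (joins-samePair G b jb p q)))
            (cong ι (joins-samePair G c jc p q))

weightAt-as-sum³ : ∀ G w e → weightAt G w e ≡
  sum³ (λ a b c → if does (canonTriangle? G a b c ×-dec ∈₃? e (a , b , c)) then w a b c else 0ℚ)
weightAt-as-sum³ G w e =
  trans (sumℚ-concatMap plane all) (trans (sumℚ-allFin (sumℚ ∘ plane)) (sum-cong-≗ λ a →
  trans (sumℚ-concatMap (row a) all) (trans (sumℚ-allFin (sumℚ ∘ row a)) (sum-cong-≗ λ b →
  sumℚ-allFin (F a b)))))
  where
  all : List (Edge G)
  all = allFin (m G)
  F : Edge G → Edge G → Edge G → ℚ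
  F a b c = if does (canonTriangle? G a b c ×-dec ∈₃? e (a , b , c)) then w a b c else 0ℚ
  row : Edge G → Edge G → List ℚ
  row a b = map (F a b) all
  plane : Edge G → List ℚ
  plane a = concatMap (row a) all

weighted-triangle : ∀ G (w : Edge G → Edge G → Edge G → ℚ) (φ : Edge G → ℚ) a b c
  (d : Dec (CanonTriangle G a b c)) →
  sum (λ e → φ e * (if does d ∧ does (∈₃? e (a , b , c)) then w a b c else 0ℚ))
    ≡ (if does d then w a b c * (φ a + φ b + φ c) else 0ℚ)
weighted-triangle G w φ a b c (no _) = sum-zero _ (λ e → ℚP.*-zeroʳ (φ e))
weighted-triangle G w φ a b c (yes (a<b , b<c , _)) = begin
    sum (λ e → φ e * (if does (∈₃? e (a , b , c)) then w a b c else 0ℚ))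
  ≡⟨ sum-cong-≗ (λ e → trans (cong (φ e *_) (if-as-ι _ (w a b c))) (rearrange (φ e) _ (w a b c))) ⟩
    sum (λ e → w a b c * φ e * ι (does (∈₃? e (a , b , c))))
  ≡⟨ sum-δ₃ (FinP.<⇒≢ a<b) (FinP.<⇒≢ b<c) (FinP.<⇒≢ (FinP.<-trans a<b b<c)) (λ e → w a b c * φ e) ⟩
    w a b c * φ a + w a b c * φ b + w a b c * φ c
  ≡⟨ factor (w a b c) (φ a) (φ b) (φ c) ⟩
    w a b c * (φ a + φ b + φ c) ∎
  where
  open ≡-Reasoning
  rearrange : ∀ f i x → f * (i * x) ≡ x * f * i
  rearrange = solve 3 (λ f i x → f :* (i :* x) := x :* f :* i) refl
  factor : ∀ x p q r → x * p + x * q + x * r ≡ x * (p + q + r)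
  factor = solve 4 (λ x p q r → x :* p :+ x :* q :+ x :* r := x :* (p :+ q :+ r)) refl

double-count : ∀ G (w : Edge G → Edge G → Edge G → ℚ) (φ : Edge G → ℚ) →
  sum (λ e → φ e * weightAt G w e) ≡
  sum³ (λ a b c → if does (canonTriangle? G a b c) then w a b c * (φ a + φ b + φ c) else 0ℚ)
double-count G w φ = begin
    sum (λ e → φ e * weightAt G w e)
  ≡⟨ sum-cong-≗ (λ e → trans (cong (φ e *_) (weightAt-as-sum³ G w e)) (*-distribˡ-sum³ (φ e) (F e))) ⟩
    sum (λ e → sum³ (λ a b c → φ e * F e a b c))
  ≡⟨ sum-sum³-comm (λ e a b c → φ e * F e a b c) ⟩
    sum³ (λ a b c → sum (λ e → φ e * F e a b c))
  ≡⟨ sum³-cong (λ a b c → weighted-triangle G w φ a b c (canonTriangle? G a b c)) ⟩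
    sum³ (λ a b c → if does (canonTriangle? G a b c) then w a b c * (φ a + φ b + φ c) else 0ℚ) ∎
  where
  open ≡-Reasoning
  F : Edge G → Edge G → Edge G → Edge G → ℚ
  F e a b c = if does (canonTriangle? G a b c ×-dec ∈₃? e (a , b , c)) then w a b c else 0ℚ

triangle-sums-determine-total : ∀ G (w : Edge G → Edge G → Edge G → ℚ) →
  (∀ e → weightAt G w e ≡ 1ℚ) → (φ ψ : Edge G → ℚ) →
  (∀ {a b c} → IsTriangle G a b c → φ a + φ b + φ c ≡ ψ a + ψ b + ψ c) → sum φ ≡ sum ψ
triangle-sums-determine-total G w w≡1 φ ψ φ≡ψ = begin
    sum φ
  ≡⟨ sum-cong-≗ (weighted φ) ⟩
    sum (λ e → φ e * weightAt G w e)
  ≡⟨ double-count G w φ ⟩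
    sum³ (λ a b c → if does (canonTriangle? G a b c) then w a b c * (φ a + φ b + φ c) else 0ℚ)
  ≡⟨ sum³-cong (λ a b c → per-triangle a b c (canonTriangle? G a b c)) ⟩
    sum³ (λ a b c → if does (canonTriangle? G a b c) then w a b c * (ψ a + ψ b + ψ c) else 0ℚ)
  ≡⟨ double-count G w ψ ⟨
    sum (λ e → ψ e * weightAt G w e)
  ≡⟨ sum-cong-≗ (weighted ψ) ⟨
    sum ψ ∎
  where
  open ≡-Reasoning
  weighted : ∀ (χ : Edge G → ℚ) e → χ e ≡ χ e * weightAt G w e
  weighted χ e = sym (trans (cong (χ e *_) (w≡1 e)) (ℚP.*-identityʳ (χ e)))
  per-triangle : ∀ a b c (d : Dec (CanonTriangle G a b c)) →
    (if does d then w a b c * (φ a + φ b + φ c) else 0ℚ) ≡ (if does d then w a b c * (ψ a + ψ b + ψ c) else 0ℚ)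
  per-triangle a b c (yes (_ , _ , abc)) = cong (w a b c *_) (φ≡ψ abc)
  per-triangle a b c (no _)              = refl

VertexTriangle : V → V → V → Set
VertexTriangle x y z = x ≢ y × y ≢ z × x ≢ z ×
  samePair x y v₁ v₂ ≡ false × samePair y z v₁ v₂ ≡ false × samePair x z v₁ v₂ ≡ false

vertexTriangle? : ∀ x y z → Dec (VertexTriangle x y z)
vertexTriangle? x y z = ¬? (x ≟ y) ×-dec ¬? (y ≟ z) ×-dec ¬? (x ≟ z) ×-dec
  (samePair x y v₁ v₂ BoolP.≟ false) ×-dec (samePair y z v₁ v₂ BoolP.≟ false) ×-dec
  (samePair x z v₁ v₂ BoolP.≟ false)

Balanced : V → V → V → Set
Balanced x y z = (sides u v₁ x y z ≡ sides v v₁ x y z) × (sides u v₂ x y z ≡ sides v v₂ x y z) ×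
  (sides u v x y z ≡ sides v v₁ x y z + sides v v₂ x y z)

balanced? : ∀ x y z → Dec (Balanced x y z)
balanced? x y z = (sides u v₁ x y z ℚP.≟ sides v v₁ x y z) ×-dec (sides u v₂ x y z ℚP.≟ sides v v₂ x y z) ×-dec
  (sides u v x y z ℚP.≟ sides v v₁ x y z + sides v v₂ x y z)

-- Every triangle of K₄ − v₁v₂ (it is uvv₁ or uvv₂) is balanced: a finite check.
vertexTriangle-balanced : ∀ x y z → VertexTriangle x y z → Balanced x y z
vertexTriangle-balanced = toWitness {a? = all? λ x → all? λ y → all? λ z → vertexTriangle? x y z →-dec balanced? x y z} tt
  where open FinP using (all?)

-- Every edge of K₄ − v₁v₂ is exactly one of uv, uv₁, vv₁, uv₂, vv₂: a finite check.
VertexEdge : V → V → Set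
VertexEdge x y = x ≢ y × samePair x y v₁ v₂ ≡ false

OnePair : V → V → Set
OnePair x y = ι (samePair x y u v) + (ι (samePair x y u v₁) + ι (samePair x y u v₂)) +
  (ι (samePair x y v v₁) + ι (samePair x y v v₂)) ≡ 1ℚ

vertexEdge-onePair : ∀ x y → VertexEdge x y → OnePair x y
vertexEdge-onePair = toWitness {a? = all? λ x → all? λ y →
  (¬? (x ≟ y) ×-dec (samePair x y v₁ v₂ BoolP.≟ false)) →-dec (_ ℚP.≟ 1ℚ)} tt
  where open FinP using (all?)

NoEdge₁₂ : Multigraph → Set
NoEdge₁₂ G = ∀ e → does (joins? G e v₁ v₂) ≡ false

none-counted : ∀ {n} {A : Set} {P : A → Set} (P? : ∀ x → Dec (P x)) (g : Fin n → A) →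
  length (filter P? (tabulate g)) ≡ 0 → ∀ i → does (P? (g i)) ≡ false
none-counted {suc n} P? g count≡0 i with does (P? (g zero)) in g₀?
none-counted {suc n} P? g ()      i       | true
none-counted {suc n} P? g count≡0 zero    | false = g₀?
none-counted {suc n} P? g count≡0 (suc i) | false = none-counted P? (g ∘ suc) count≡0 i

noEdge₁₂ : ∀ G → μ G v₁ v₂ ≡ 0 → NoEdge₁₂ G
noEdge₁₂ G μ≡0 = none-counted (λ e → joins? G e v₁ v₂) id μ≡0

edge-onePair : ∀ G → NoEdge₁₂ G → ∀ e →
  𝟙 G u v e + (𝟙 G u v₁ e + 𝟙 G u v₂ e) + (𝟙 G v v₁ e + 𝟙 G v v₂ e) ≡ 1ℚ
edge-onePair G no₁₂ e = vertexEdge-onePair (end₁ G e) (end₂ G e) (loopless G e , no₁₂ e)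

BalancedEdges : (G : Multigraph) → Edge G → Edge G → Edge G → Set
BalancedEdges G a b c = (hits G u v₁ a b c ≡ hits G v v₁ a b c) × (hits G u v₂ a b c ≡ hits G v v₂ a b c) ×
  (hits G u v a b c ≡ hits G v v₁ a b c + hits G v v₂ a b c)

-- Every triangle of G is balanced, because its vertex triangle is one of K₄ − v₁v₂.
triangle-balanced : ∀ G → NoEdge₁₂ G → ∀ {a b c} → IsTriangle G a b c → BalancedEdges G a b c
triangle-balanced G no₁₂ {a} {b} {c} (x , y , z , x≢y , y≢z , x≢z , ja , jb , jc) =
  via-sides (proj₁ balanced) , via-sides (proj₁ (proj₂ balanced)) ,
  trans (hits≡sides u v) (trans (proj₂ (proj₂ balanced)) (sym (cong₂ _+_ (hits≡sides v v₁) (hits≡sides v v₂))))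
  where
  hits≡sides : ∀ p q → hits G p q a b c ≡ sides p q x y z
  hits≡sides = hits-sides G ja jb jc
  via-sides : ∀ {p q p′ q′} → sides p q x y z ≡ sides p′ q′ x y z → hits G p q a b c ≡ hits G p′ q′ a b c
  via-sides {p} {q} {p′} {q′} eq = trans (hits≡sides p q) (trans eq (sym (hits≡sides p′ q′)))
  off₁₂ : ∀ {e s t} → Joins G e s t → samePair s t v₁ v₂ ≡ false
  off₁₂ {e} j = trans (sym (joins-samePair G e j v₁ v₂)) (no₁₂ e)
  balanced : Balanced x y z
  balanced = vertexTriangle-balanced x y z (x≢y , y≢z , x≢z , off₁₂ ja , off₁₂ jb , off₁₂ jc)

Balance : Multigraph → Set
Balance G = (μ G u v ≡ μ G v v₁ ℕ.+ μ G v v₂) × (μ G u v₁ ≡ μ G v v₁) × (μ G u v₂ ≡ μ G v v₂)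

μ-as-sum : ∀ G p q → ⟦ μ G p q ⟧ ≡ sum (𝟙 G p q)
μ-as-sum G p q = trans (count-as-sumℚ (λ e → joins? G e p q) (allFin (m G))) (sumℚ-allFin (𝟙 G p q))

rational⇒balance : ∀ G → NoEdge₁₂ G → RationallyK3Decomposable G → Balance G
rational⇒balance G no₁₂ (w , _ , w≡1) =
  ⟦⟧-injective uv-count ,
  ⟦⟧-injective (same-count u v₁ v v₁ (proj₁ ∘ balanced)) ,
  ⟦⟧-injective (same-count u v₂ v v₂ (proj₁ ∘ proj₂ ∘ balanced))
  where
  open ≡-Reasoning
  balanced : ∀ {a b c} → IsTriangle G a b c → BalancedEdges G a b c
  balanced = triangle-balanced G no₁₂
  transfer : (φ ψ : Edge G → ℚ) → (∀ {a b c} → IsTriangle G a b c → φ a + φ b + φ c ≡ ψ a + ψ b + ψ c) →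
    sum φ ≡ sum ψ
  transfer = triangle-sums-determine-total G w w≡1
  same-count : ∀ p q p′ q′ → (∀ {a b c} → IsTriangle G a b c → hits G p q a b c ≡ hits G p′ q′ a b c) →
    ⟦ μ G p q ⟧ ≡ ⟦ μ G p′ q′ ⟧
  same-count p q p′ q′ same-hits =
    trans (μ-as-sum G p q) (trans (transfer (𝟙 G p q) (𝟙 G p′ q′) same-hits) (sym (μ-as-sum G p′ q′)))
  ψ : Edge G → ℚ
  ψ e = 𝟙 G v v₁ e + 𝟙 G v v₂ e
  uv-hits : ∀ {a b c} → IsTriangle G a b c → hits G u v a b c ≡ ψ a + ψ b + ψ c
  uv-hits {a} {b} {c} abc = trans (proj₂ (proj₂ (balanced abc)))
    (+-regroup₃ (𝟙 G v v₁ a) (𝟙 G v v₁ b) (𝟙 G v v₁ c) (𝟙 G v v₂ a) (𝟙 G v v₂ b) (𝟙 G v v₂ c))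
  uv-count : ⟦ μ G u v ⟧ ≡ ⟦ μ G v v₁ ℕ.+ μ G v v₂ ⟧
  uv-count = begin
      ⟦ μ G u v ⟧
    ≡⟨ μ-as-sum G u v ⟩
      sum (𝟙 G u v)
    ≡⟨ transfer (𝟙 G u v) ψ uv-hits ⟩
      sum ψ
    ≡⟨ ∑-distrib-+ (𝟙 G v v₁) (𝟙 G v v₂) ⟩
      sum (𝟙 G v v₁) + sum (𝟙 G v v₂)
    ≡⟨ cong₂ _+_ (μ-as-sum G v v₁) (μ-as-sum G v v₂) ⟨
      ⟦ μ G v v₁ ⟧ + ⟦ μ G v v₂ ⟧
    ≡⟨ ×-homo-+ 1ℚ (μ G v v₁) (μ G v v₂) ⟨
      ⟦ μ G v v₁ ℕ.+ μ G v v₂ ⟧ ∎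

sort3 : ∀ {n} → Triple n → Triple n
sort3 (a , b , c) with a <? b | b <? c | a <? c
... | yes _ | yes _ | _     = a , b , c
... | yes _ | no _  | yes _ = a , c , b
... | yes _ | no _  | no _  = c , a , b
... | no _  | yes _ | yes _ = b , a , c
... | no _  | yes _ | no _  = b , c , a
... | no _  | no _  | _     = c , b , a

data Perm3 {n} : Triple n → Triple n → Set where
  stay  : ∀ {t} → Perm3 t t
  swap₁₂ : ∀ {a b c} → Perm3 (a , b , c) (b , a , c)
  swap₂₃ : ∀ {a b c} → Perm3 (a , b , c) (a , c , b)
  _then_ : ∀ {s t r} → Perm3 s t → Perm3 t r → Perm3 s r

sort3-perm : ∀ {n} (t : Triple n) → Perm3 t (sort3 t)
sort3-perm (a , b , c) with a <? b | b <? c | a <? c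
... | yes _ | yes _ | _     = stay
... | yes _ | no _  | yes _ = swap₂₃
... | yes _ | no _  | no _  = swap₂₃ then swap₁₂
... | no _  | yes _ | yes _ = swap₁₂
... | no _  | yes _ | no _  = swap₁₂ then swap₂₃
... | no _  | no _  | _     = swap₁₂ then (swap₂₃ then swap₁₂)

≮∧≢⇒> : ∀ {n} {x y : Fin n} → ¬ x <ᶠ y → x ≢ y → y <ᶠ x
≮∧≢⇒> x≮y x≢y = FinP.≤∧≢⇒< (ℕP.≮⇒≥ x≮y) (x≢y ∘ sym)

Sorted : ∀ {n} → Triple n → Set
Sorted (a , b , c) = a <ᶠ b × b <ᶠ c

sort3-sorted : ∀ {n} {a b c : Fin n} → a ≢ b → b ≢ c → a ≢ c → Sorted (sort3 (a , b , c))
sort3-sorted {a = a} {b} {c} a≢b b≢c a≢c with a <? b | b <? c | a <? c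
... | yes a<b | yes b<c | _       = a<b , b<c
... | yes a<b | no b≮c  | yes a<c = a<c , ≮∧≢⇒> b≮c b≢c
... | yes a<b | no b≮c  | no a≮c  = ≮∧≢⇒> a≮c a≢c , a<b
... | no a≮b  | yes b<c | yes a<c = ≮∧≢⇒> a≮b a≢b , a<c
... | no a≮b  | yes b<c | no a≮c  = b<c , ≮∧≢⇒> a≮c a≢c
... | no a≮b  | no b≮c  | _       = ≮∧≢⇒> b≮c b≢c , ≮∧≢⇒> a≮b a≢b

∈₃-perm : ∀ {n} {t t′ : Triple n} → Perm3 t t′ → ∀ e → does (∈₃? e t) ≡ does (∈₃? e t′)
∈₃-perm stay e = refl
∈₃-perm (swap₁₂ {a} {b} {c}) e = exchange (does (e ≟ a)) (does (e ≟ b)) (does (e ≟ c))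
  where
  exchange : ∀ p q r → p ∨ q ∨ r ≡ q ∨ p ∨ r
  exchange p q r = trans (sym (BoolP.∨-assoc p q r)) (trans (cong (_∨ r) (BoolP.∨-comm p q)) (BoolP.∨-assoc q p r))
∈₃-perm (swap₂₃ {a} {b} {c}) e = cong (does (e ≟ a) ∨_) (BoolP.∨-comm (does (e ≟ b)) (does (e ≟ c)))
∈₃-perm (π then π′) e = trans (∈₃-perm π e) (∈₃-perm π′ e)

IsTriangle₃ : (G : Multigraph) → Triple (m G) → Set
IsTriangle₃ G (a , b , c) = IsTriangle G a b c

IsTriangle-perm : ∀ G {t t′ : Triple (m G)} → Perm3 t t′ → IsTriangle₃ G t → IsTriangle₃ G t′
IsTriangle-perm G stay abc = abc
IsTriangle-perm G (swap₁₂ {a} {b} {c}) (x , y , z , x≢y , y≢z , x≢z , ja , jb , jc) =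
  z , y , x , y≢z ∘ sym , x≢y ∘ sym , x≢z ∘ sym , Joins-sym G b jb , Joins-sym G a ja , Joins-sym G c jc
IsTriangle-perm G (swap₂₃ {a}) (x , y , z , x≢y , y≢z , x≢z , ja , jb , jc) =
  y , x , z , x≢y ∘ sym , x≢z , y≢z , Joins-sym G a ja , jc , jb
IsTriangle-perm G (π then π′) abc = IsTriangle-perm G π′ (IsTriangle-perm G π abc)

sort3-canonical : ∀ G {t} → IsTriangle₃ G t → ∀ e →
  let (a , b , c) = sort3 t in
  does (canonTriangle? G a b c) ∧ does (∈₃? e (a , b , c)) ≡ does (∈₃? e t)
sort3-canonical G {t@(a , b , c)} abc e =
  trans (cong (_∧ does (∈₃? e (sort3 t))) canonical) (sym (∈₃-perm (sort3-perm t) e))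
  where
  distinct : a ≢ b × b ≢ c × a ≢ c
  distinct = triangle-edges-distinct G abc
  sorted : Sorted (sort3 t)
  sorted = sort3-sorted (proj₁ distinct) (proj₁ (proj₂ distinct)) (proj₂ (proj₂ distinct))
  canonical : does (canonTriangle? G (proj₁ (sort3 t)) (proj₁ (proj₂ (sort3 t))) (proj₂ (proj₂ (sort3 t)))) ≡ true
  canonical = dec-true (canonTriangle? G _ _ _) (proj₁ sorted , proj₂ sorted , IsTriangle-perm G (sort3-perm t) abc)

decomposition⇒rational : ∀ G → K3Decomposable G → RationallyK3Decomposable G
decomposition⇒rational G (T , triangles , once) = w , (λ a b c _ → w-nonneg a b c) , w-at
  where
  τ : Fin (length T) → Triple (m G)
  τ = lookup T
  w : Edge G → Edge G → Edge G → ℚ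
  w a b c = sum (λ i → δ₃ (sort3 (τ i)) a b c)
  w-nonneg : ∀ a b c → 0ℚ ≤ w a b c
  w-nonneg a b c = sum-nonneg (λ i → δ₃ (sort3 (τ i)) a b c) (λ i → δ₃-nonneg (sort3 (τ i)) a b c)
  g : Edge G → Edge G → Edge G → Edge G → ℚ
  g e a b c = ι (does (canonTriangle? G a b c) ∧ does (∈₃? e (a , b , c)))
  τ-triangle : ∀ i → IsTriangle₃ G (τ i)
  τ-triangle i = All.lookup triangles (∈-lookup i)
  w-at : ∀ e → weightAt G w e ≡ 1ℚ
  w-at e = begin
      weightAt G w e
    ≡⟨ weightAt-as-sum³ G w e ⟩
      sum³ (λ a b c → if does (canonTriangle? G a b c ×-dec ∈₃? e (a , b , c)) then w a b c else 0ℚ)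
    ≡⟨ sum³-cong (λ a b c → trans (if-as-ι _ (w a b c)) (*-distribˡ-sum (g e a b c) (λ i → δ₃ (sort3 (τ i)) a b c))) ⟩
      sum³ (λ a b c → sum (λ i → g e a b c * δ₃ (sort3 (τ i)) a b c))
    ≡⟨ sum-sum³-comm (λ i a b c → g e a b c * δ₃ (sort3 (τ i)) a b c) ⟨
      sum (λ i → sum³ (λ a b c → g e a b c * δ₃ (sort3 (τ i)) a b c))
    ≡⟨ sum-cong-≗ (λ i → sum³-δ (g e) (sort3 (τ i))) ⟩
      sum (λ i → g e (proj₁ (sort3 (τ i))) (proj₁ (proj₂ (sort3 (τ i)))) (proj₂ (proj₂ (sort3 (τ i)))))
    ≡⟨ sum-cong-≗ (λ i → cong ι (sort3-canonical G (τ-triangle i) e)) ⟩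
      sum (λ i → ι (does (∈₃? e (τ i))))
    ≡⟨ sumℚ-lookup (ι ∘ does ∘ ∈₃? e) T ⟨
      sumℚ (map (ι ∘ does ∘ ∈₃? e) T)
    ≡⟨ count-as-sumℚ (∈₃? e) T ⟨
      ⟦ length (filter (∈₃? e) T) ⟧
    ≡⟨ cong ⟦_⟧ (once e) ⟩
      1ℚ ∎
    where open ≡-Reasoning

δ-sym : ∀ {n} (x y : Fin n) → δ x y ≡ δ y x
δ-sym x y with x ≟ y | y ≟ x
... | yes _   | yes _   = refl
... | no _    | no _    = refl
... | yes x≡y | no y≢x  = ⊥-elim (y≢x (sym x≡y))
... | no x≢y  | yes y≡x = ⊥-elim (x≢y (sym y≡x))

mult : ∀ {n} → Fin n → List (Fin n) → ℚ
mult e xs = sumℚ (map (λ x → δ x e) xs)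

mult-take-drop : ∀ {n} (e : Fin n) k xs → mult e (take k xs) + mult e (drop k xs) ≡ mult e xs
mult-take-drop e k xs = begin
    mult e (take k xs) + mult e (drop k xs)
  ≡⟨ sumℚ-++ (map δe (take k xs)) (map δe (drop k xs)) ⟨
    sumℚ (map δe (take k xs) ++ map δe (drop k xs))
  ≡⟨ cong sumℚ (ListP.map-++ δe (take k xs) (drop k xs)) ⟨
    mult e (take k xs ++ drop k xs)
  ≡⟨ cong (mult e) (ListP.take++drop≡id k xs) ⟩
    mult e xs ∎
  where
  open ≡-Reasoning
  δe : Fin _ → ℚ
  δe x = δ x e

mult-filter-allFin : ∀ {n} (e : Fin n) {P : Fin n → Set} (P? : ∀ x → Dec (P x)) →
  mult e (filter P? (allFin n)) ≡ ι (does (P? e))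
mult-filter-allFin {n} e P? = begin
    mult e (filter P? (allFin n))
  ≡⟨ sumℚ-filter P? (λ x → δ x e) (allFin n) ⟩
    sumℚ (map (λ x → ι (does (P? x)) * δ x e) (allFin n))
  ≡⟨ sumℚ-allFin (λ x → ι (does (P? x)) * δ x e) ⟩
    sum (λ x → ι (does (P? x)) * δ x e)
  ≡⟨ sum-cong-≗ (λ x → cong (ι (does (P? x)) *_) (δ-sym x e)) ⟩
    sum (λ x → ι (does (P? x)) * δ e x)
  ≡⟨ sum-δ e (λ x → ι (does (P? x))) ⟩
    ι (does (P? e)) ∎
  where open ≡-Reasoning

triples : ∀ {A : Set} → List A → List A → List A → List (A × A × A)
triples as bs cs = zip as (zip bs cs)

All-zip : ∀ {A B : Set} {P : A → Set} {Q : B → Set} {as bs} →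
  All P as → All Q bs → All (λ ab → P (proj₁ ab) × Q (proj₂ ab)) (zip as bs)
All-zip []       _        = []
All-zip (_ ∷ _)  []       = []
All-zip (p ∷ ps) (q ∷ qs) = (p , q) ∷ All-zip ps qs

Distinct₃ : ∀ {n} → Triple n → Set
Distinct₃ (a , b , c) = a ≢ b × b ≢ c × a ≢ c

triples-membership : ∀ {n} (e : Fin n) (as bs cs : List (Fin n)) →
  length as ≡ length bs → length bs ≡ length cs → All Distinct₃ (triples as bs cs) →
  sumℚ (map (ι ∘ does ∘ ∈₃? e) (triples as bs cs)) ≡ mult e as + mult e bs + mult e cs
triples-membership e []       []       []       _  _  _ = refl
triples-membership e (a ∷ as) (b ∷ bs) (c ∷ cs) ∣a∣≡∣b∣ ∣b∣≡∣c∣ ((a≢b , b≢c , a≢c) ∷ distinct) =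
  trans (cong₂ _+_ (∈₃-as-ι a≢b b≢c a≢c e)
                   (triples-membership e as bs cs (ℕP.suc-injective ∣a∣≡∣b∣) (ℕP.suc-injective ∣b∣≡∣c∣) distinct))
        (+-regroup₃ (δ a e) (δ b e) (δ c e) (mult e as) (mult e bs) (mult e cs))

balance⇒decomposition : ∀ G → NoEdge₁₂ G → Balance G → K3Decomposable G
balance⇒decomposition G no₁₂ (μuv≡ , μuv₁≡ , μuv₂≡) = T , triangles , once
  where
  open ≡-Reasoning
  edges : V → V → List (Edge G)
  edges p q = filter (λ e → joins? G e p q) (allFin (m G))
  joining : ∀ p q → All (λ e → Joins G e p q) (edges p q)
  joining p q = AllP.all-filter (λ e → joins? G e p q) (allFin (m G))
  k : ℕ
  k = μ G v v₁
  T₁ T₂ T : List (Triple (m G))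
  T₁ = triples (take k (edges u v)) (edges u v₁) (edges v v₁)
  T₂ = triples (drop k (edges u v)) (edges u v₂) (edges v v₂)
  T  = T₁ ++ T₂
  triangle : ∀ w {a b c} → u ≢ w → v ≢ w → Joins G a u v → Joins G b u w → Joins G c v w → IsTriangle G a b c
  triangle w {a} u≢w v≢w ja jb jc = v , u , w , (λ ()) , u≢w , v≢w , Joins-sym G a ja , jb , jc
  triangles-via : ∀ w {as} → u ≢ w → v ≢ w → All (λ e → Joins G e u v) as →
    All (IsTriangle₃ G) (triples as (edges u w) (edges v w))
  triangles-via w u≢w v≢w uv-edges =
    All.map (λ (ja , jb , jc) → triangle w u≢w v≢w ja jb jc) (All-zip uv-edges (All-zip (joining u w) (joining v w)))
  triangles₁ : All (IsTriangle₃ G) T₁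
  triangles₁ = triangles-via v₁ (λ ()) (λ ()) (AllP.take⁺ k (joining u v))
  triangles₂ : All (IsTriangle₃ G) T₂
  triangles₂ = triangles-via v₂ (λ ()) (λ ()) (AllP.drop⁺ k (joining u v))
  triangles : All (IsTriangle₃ G) T
  triangles = AllP.++⁺ triangles₁ triangles₂
  distinct : ∀ {ts} → All (IsTriangle₃ G) ts → All Distinct₃ ts
  distinct = All.map (triangle-edges-distinct G)
  ∣take∣ : length (take k (edges u v)) ≡ length (edges u v₁)
  ∣take∣ = begin
      length (take k (edges u v))   ≡⟨ ListP.length-take k (edges u v) ⟩
      k ℕ.⊓ μ G u v                 ≡⟨ cong (k ℕ.⊓_) μuv≡ ⟩
      k ℕ.⊓ (k ℕ.+ μ G v v₂)        ≡⟨ ℕP.m≤n⇒m⊓n≡m (ℕP.m≤m+n k (μ G v v₂)) ⟩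
      k                             ≡⟨ μuv₁≡ ⟨
      μ G u v₁                      ∎
  ∣drop∣ : length (drop k (edges u v)) ≡ length (edges u v₂)
  ∣drop∣ = begin
      length (drop k (edges u v))   ≡⟨ ListP.length-drop k (edges u v) ⟩
      μ G u v ℕ.∸ k                 ≡⟨ cong (ℕ._∸ k) μuv≡ ⟩
      (k ℕ.+ μ G v v₂) ℕ.∸ k        ≡⟨ ℕP.m+n∸m≡n k (μ G v v₂) ⟩
      μ G v v₂                      ≡⟨ μuv₂≡ ⟨
      μ G u v₂                      ∎
  once : ∀ e → length (filter (∈₃? e) T) ≡ 1
  once e = ⟦⟧-injective (begin
      ⟦ length (filter (∈₃? e) T) ⟧
    ≡⟨ count-as-sumℚ (∈₃? e) T ⟩
      sumℚ (map χₑ T)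
    ≡⟨ trans (cong sumℚ (ListP.map-++ χₑ T₁ T₂)) (sumℚ-++ (map χₑ T₁) (map χₑ T₂)) ⟩
      sumℚ (map χₑ T₁) + sumℚ (map χₑ T₂)
    ≡⟨ cong₂ _+_ (triples-membership e _ _ _ ∣take∣ μuv₁≡ (distinct triangles₁))
                 (triples-membership e _ _ _ ∣drop∣ μuv₂≡ (distinct triangles₂)) ⟩
      (M (take k (edges u v)) + M (edges u v₁) + M (edges v v₁)) +
      (M (drop k (edges u v)) + M (edges u v₂) + M (edges v v₂))
    ≡⟨ +-regroup₃ (M (take k (edges u v))) (M (edges u v₁)) (M (edges v v₁))
                  (M (drop k (edges u v))) (M (edges u v₂)) (M (edges v v₂)) ⟩
      (M (take k (edges u v)) + M (drop k (edges u v))) + (M (edges u v₁) + M (edges u v₂)) +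
      (M (edges v v₁) + M (edges v v₂))
    ≡⟨ cong (λ x → x + (M (edges u v₁) + M (edges u v₂)) + (M (edges v v₁) + M (edges v v₂)))
            (mult-take-drop e k (edges u v)) ⟩
      M (edges u v) + (M (edges u v₁) + M (edges u v₂)) + (M (edges v v₁) + M (edges v v₂))
    ≡⟨ cong₂ _+_ (cong₂ _+_ (M-edges u v) (cong₂ _+_ (M-edges u v₁) (M-edges u v₂)))
                 (cong₂ _+_ (M-edges v v₁) (M-edges v v₂)) ⟩
      𝟙 G u v e + (𝟙 G u v₁ e + 𝟙 G u v₂ e) + (𝟙 G v v₁ e + 𝟙 G v v₂ e)
    ≡⟨ edge-onePair G no₁₂ e ⟩
      1ℚ ∎)
    where
    χₑ : Triple (m G) → ℚ
    χₑ = ι ∘ does ∘ ∈₃? e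
    M : List (Edge G) → ℚ
    M = mult e
    M-edges : ∀ p q → M (edges p q) ≡ 𝟙 G p q e
    M-edges p q = mult-filter-allFin e (λ e′ → joins? G e′ p q)

corollary11 : (G : Multigraph) → UnderlyingK4-e G →
    (RationallyK3Decomposable G ⇔ K3Decomposable G) ×
    (K3Decomposable G ⇔
      (μ G u v ≡ μ G v v₁ ℕ.+ μ G v v₂ × μ G u v₁ ≡ μ G v v₁ × μ G u v₂ ≡ μ G v v₂))
corollary11 G (_ , _ , _ , _ , _ , μ₁₂≡0) =
  mk⇔ (balance⇒decomposition G no₁₂ ∘ rational⇒balance G no₁₂) (decomposition⇒rational G) ,
  mk⇔ (rational⇒balance G no₁₂ ∘ decomposition⇒rational G) (balance⇒decomposition G no₁₂)
  where
  no₁₂ : NoEdge₁₂ G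
  no₁₂ = noEdge₁₂ G μ₁₂≡0
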